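{- Every descendant chain $U$ satisfies $\mathbf{u}_i\times\mathbf{u}_j>0$ for all $1\le i<j\le 4$, where $\mathbf{u}_1,\dots,\mathbf{u}_8$ are its partial vectors.
   Context: Words are over $\{\mathsf{R},\mathsf{L},\mathsf{U},\mathsf{D}\}$ with reversal $\mathsf{R}\leftrightarrow\mathsf{L}$, $\mathsf{U}\leftrightarrow\mathsf{D}$, and $(w_1\cdots w_k)^{ -1}=w_k^{ -1}\cdots w_1^{ -1}$. Chains $U_1:\cdots:U_8$ have indices modulo $8$. Lifts, for $V=\varphi(U)$: - $f_i$, for $i=1,\dots,4$: $V_j=U_j$ for $j\not\equiv i\pmod 4$, and $V_j=(U_{j+3}U_{j+4}U_{j+5})^{ -1}$ for $j\equiv i\pmod 4$. - $g^\star_{\mathrm{odd}}$: $V_i=(U_{i-2}\cdots U_{i+2})^{ -1}$ for odd $i$, and $V_i=U_{i+3}U_{i+4}U_{i+5}$ for even $i$. - $g^\star_{\mathrm{even}}$: "odd" and "even" swapped. A descendant chain is obtained from the Greek cross $\mathsf{R}:\mathsf{U}\mathsf{R}:\mathsf{U}:\mathsf{L}\mathsf{U}:\mathsf{L}:\mathsf{D}\mathsf{L}:\mathsf{D}:\mathsf{R}\mathsf{D}$ by a finite sequence of these maps. The partial vector $\mathbf{u}_i$ is the span of $U_i$, namely $(\#\mathsf{R}-\#\mathsf{L},\ \#\mathsf{U}-\#\mathsf{D})$ counted in $U_i$. For vectors, $(x_1,y_1)\times(x_2,y_2)=x_1y_2-y_1x_2$. -}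

module Defs where

open import Data.Nat using (ℕ; zero; suc; _+_; _%_; _≡ᵇ_)
open import Data.Bool using (Bool; true; false; if_then_else_)
open import Data.Integer as ℤ using (ℤ; +_; _-_; _*_; _>_)
open import Data.Fin as Fin using (Fin; toℕ; fromℕ<)
open import Data.Nat.DivMod using (_mod_)
open import Data.List using (List; []; _∷_; _++_; reverse; map)
open import Data.Product using (_×_; _,_)

data Letter : Set where
  R L U D : Letter

Word : Set
Word = List Letter

inv : Letter → Letter
inv R = L
inv L = R
inv U = D
inv D = U

_⁻¹ : Word → Word
w ⁻¹ = reverse (map inv w)

-- A chain U₁ : ⋯ : U₈.  Position k : Fin 8 holds U_{k+1}.
Chain : Set
Chain = Fin 8 → Word

-- 1-based indexing modulo 8:  C ⟨ n ⟩ = U_n with n read modulo 8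
-- (C ⟨ 8 ⟩ = C ⟨ 0 ⟩ = U₈, C ⟨ 9 ⟩ = U₁, ...).  Negative offsets i - a are
-- written i + (8 - a).
_⟨_⟩ : Chain → ℕ → Word
C ⟨ n ⟩ = C ((n + 7) mod 8)

idx : Fin 8 → ℕ
idx k = suc (toℕ k)

tri : Chain → ℕ → Word
tri C j = C ⟨ j + 3 ⟩ ++ C ⟨ j + 4 ⟩ ++ C ⟨ j + 5 ⟩

pent : Chain → ℕ → Word
pent C i = C ⟨ i + 6 ⟩ ++ C ⟨ i + 7 ⟩ ++ C ⟨ i ⟩ ++ C ⟨ i + 1 ⟩ ++ C ⟨ i + 2 ⟩

isOdd : ℕ → Bool
isOdd n = n % 2 ≡ᵇ 1

f : ℕ → Chain → Chain
f i C k = if idx k % 4 ≡ᵇ i % 4 then tri C (idx k) ⁻¹ else C k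

gOdd : Chain → Chain
gOdd C k = if isOdd (idx k) then pent C (idx k) ⁻¹ else tri C (idx k)

gEven : Chain → Chain
gEven C k = if isOdd (idx k) then tri C (idx k) else pent C (idx k) ⁻¹

greekCross : Chain
greekCross Fin.zero = R ∷ []
greekCross (Fin.suc Fin.zero) = U ∷ R ∷ []
greekCross (Fin.suc (Fin.suc Fin.zero)) = U ∷ []
greekCross (Fin.suc (Fin.suc (Fin.suc Fin.zero))) = L ∷ U ∷ []
greekCross (Fin.suc (Fin.suc (Fin.suc (Fin.suc Fin.zero)))) = L ∷ []
greekCross (Fin.suc (Fin.suc (Fin.suc (Fin.suc (Fin.suc Fin.zero))))) = D ∷ L ∷ []
greekCross (Fin.suc (Fin.suc (Fin.suc (Fin.suc (Fin.suc (Fin.suc Fin.zero)))))) = D ∷ []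
greekCross (Fin.suc (Fin.suc (Fin.suc (Fin.suc (Fin.suc (Fin.suc (Fin.suc Fin.zero))))))) = R ∷ D ∷ []

data Step : Chain → Chain → Set where
  stepF₁ : ∀ C → Step C (f 1 C)
  stepF₂ : ∀ C → Step C (f 2 C)
  stepF₃ : ∀ C → Step C (f 3 C)
  stepF₄ : ∀ C → Step C (f 4 C)
  stepGOdd : ∀ C → Step C (gOdd C)
  stepGEven : ∀ C → Step C (gEven C)

data Descendant : Chain → Set where
  cross : Descendant greekCross
  step : ∀ {C C'} → Descendant C → Step C C' → Descendant C'

span : Word → ℤ × ℤ
span [] = (+ 0 , + 0)
span (a ∷ w) with span w
... | (x , y) with a
...   | R = (x ℤ.+ + 1 , y)
...   | L = (x - + 1 , y)
...   | U = (x , y ℤ.+ + 1)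
...   | D = (x , y - + 1)

partial : Chain → Fin 8 → ℤ × ℤ
partial C k = span (C k)

cross2 : ℤ × ℤ → ℤ × ℤ → ℤ
cross2 (x₁ , y₁) (x₂ , y₂) = x₁ * y₂ - y₁ * x₂

module Submission where

-- Spans turn concatenation into addition and word reversal into negation, so each of the six
-- maps acts linearly on partial vectors.  Applied to a chain with partial vectors
-- u₁, u₂, u₃, u₄, -u₁, -u₂, -u₃, -u₄ it yields a chain of the same shape whose new u₁, …, u₄
-- are integer combinations of the old ones; the 4 × 4 matrix (and the shape) are obtained by
-- running the map on formal coefficient vectors.  By Binet–Cauchy each new uᵢ × uⱼ is then a
-- combination of the old ones with 2 × 2 minors of that matrix as coefficients; for each map
-- these minors are non-negative and not all zero, so positivity of the six uᵢ × uⱼ (i < j ≤ 4),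
-- which holds for the Greek cross, is inherited by every descendant.

open import Defs
  using (Letter; R; L; U; D; inv; _⁻¹; Chain; idx; isOdd; greekCross;
         Step; stepF₁; stepF₂; stepF₃; stepF₄; stepGOdd; stepGEven;
         Descendant; cross; step; span; partial; cross2)
open import Data.Nat using (ℕ)
open import Data.Fin using (Fin; toℕ)
open import Data.Integer using (_>_; +_)

open import Data.Bool using (true; false; if_then_else_)
open import Data.Fin as Fin using (zero; suc; splitAt)
open import Data.Integer using (ℤ; +0; +[1+_]; _+_; _*_; -_; _-_; _≤_; _<_; +≤+; +<+; _≤?_; _<?_)
import Data.Integer.Properties as ℤ
open import Data.Integer.Tactic.RingSolver using (solve-∀)
open import Data.List using ([]; _∷_; _++_; [_]; reverse; map)
import Data.List.Properties as List
open import Data.Nat using (z≤n; s≤s; _%_; _≡ᵇ_)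
import Data.Nat as ℕ
open import Data.Nat.DivMod using (_mod_)
open import Data.Product using (_×_; _,_; uncurry)
import Data.Product.Properties as Product
open import Data.Sum using (inj₁; inj₂)
open import Data.Vec as Vec using (Vec; []; _∷_; lookup; tabulate; zip; zipWith; replicate)
import Data.Vec.Properties as Vec
open import Data.Vec.Relation.Unary.All using (All; []; _∷_; all?)
open import Data.Vec.Relation.Unary.Any using (Any; here; there; any?)
import Data.Fin.Properties as Fin
open import Function using (_∘_)
open import Relation.Binary.PropositionalEquality
  using (_≡_; refl; sym; trans; cong; cong₂; subst; subst₂; module ≡-Reasoning)
open import Relation.Nullary.Decidable using (Dec; _×-dec_; from-yes)
open import Algebra.Properties.CommutativeSemigroup ℤ.+-commutativeSemigroup using (interchange)

V : Set
V = ℤ × ℤ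

infixl 6 _⊕_
infixr 7 _⊛_
infix 8 ⊖_

𝟎 : V
𝟎 = + 0 , + 0

_⊕_ : V → V → V
(x , y) ⊕ (x′ , y′) = x + x′ , y + y′

⊖_ : V → V
⊖ (x , y) = - x , - y

_⊛_ : ℤ → V → V
a ⊛ (x , y) = a * x , a * y

⊕-identityˡ : ∀ u → 𝟎 ⊕ u ≡ u
⊕-identityˡ (x , y) = cong₂ _,_ (ℤ.+-identityˡ x) (ℤ.+-identityˡ y)

⊕-assoc : ∀ u v w → (u ⊕ v) ⊕ w ≡ u ⊕ (v ⊕ w)
⊕-assoc (x , y) (x′ , y′) (x″ , y″) = cong₂ _,_ (ℤ.+-assoc x x′ x″) (ℤ.+-assoc y y′ y″)

⊕-identityʳ : ∀ u → u ⊕ 𝟎 ≡ u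
⊕-identityʳ (x , y) = cong₂ _,_ (ℤ.+-identityʳ x) (ℤ.+-identityʳ y)

⊕-comm : ∀ u v → u ⊕ v ≡ v ⊕ u
⊕-comm (x , y) (x′ , y′) = cong₂ _,_ (ℤ.+-comm x x′) (ℤ.+-comm y y′)

⊕-interchange : ∀ u v w z → (u ⊕ v) ⊕ (w ⊕ z) ≡ (u ⊕ w) ⊕ (v ⊕ z)
⊕-interchange (x , y) (x′ , y′) (x″ , y″) (x‴ , y‴) =
  cong₂ _,_ (interchange x x′ x″ x‴) (interchange y y′ y″ y‴)

⊖-distrib-⊕ : ∀ u v → ⊖ (u ⊕ v) ≡ ⊖ u ⊕ ⊖ v
⊖-distrib-⊕ (x , y) (x′ , y′) = cong₂ _,_ (ℤ.neg-distrib-+ x x′) (ℤ.neg-distrib-+ y y′)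

⊛-identityˡ : ∀ u → + 1 ⊛ u ≡ u
⊛-identityˡ (x , y) = cong₂ _,_ (ℤ.*-identityˡ x) (ℤ.*-identityˡ y)

⊛-distribʳ-+ : ∀ a b u → (a + b) ⊛ u ≡ a ⊛ u ⊕ b ⊛ u
⊛-distribʳ-+ a b (x , y) = cong₂ _,_ (ℤ.*-distribʳ-+ x a b) (ℤ.*-distribʳ-+ y a b)

-‿⊛ : ∀ a u → (- a) ⊛ u ≡ ⊖ (a ⊛ u)
-‿⊛ a (x , y) = cong₂ _,_ (sym (ℤ.neg-distribˡ-* a x)) (sym (ℤ.neg-distribˡ-* a y))

direction : Letter → V
direction R = + 1 , + 0
direction L = - + 1 , + 0
direction U = + 0 , + 1
direction D = + 0 , - + 1

span-∷ : ∀ a w → span (a ∷ w) ≡ direction a ⊕ span w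
span-∷ a w with span w
... | x , y with a
...   | R = cong₂ _,_ (ℤ.+-comm x (+ 1)) (sym (ℤ.+-identityˡ y))
...   | L = cong₂ _,_ (ℤ.+-comm x (- + 1)) (sym (ℤ.+-identityˡ y))
...   | U = cong₂ _,_ (sym (ℤ.+-identityˡ x)) (ℤ.+-comm y (+ 1))
...   | D = cong₂ _,_ (sym (ℤ.+-identityˡ x)) (ℤ.+-comm y (- + 1))

span-++ : ∀ w w′ → span (w ++ w′) ≡ span w ⊕ span w′
span-++ []      w′ = sym (⊕-identityˡ (span w′))
span-++ (a ∷ w) w′ = begin
  span (a ∷ w ++ w′)                ≡⟨ span-∷ a (w ++ w′) ⟩
  direction a ⊕ span (w ++ w′)      ≡⟨ cong (direction a ⊕_) (span-++ w w′) ⟩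
  direction a ⊕ (span w ⊕ span w′)  ≡⟨ ⊕-assoc (direction a) (span w) (span w′) ⟨
  direction a ⊕ span w ⊕ span w′    ≡⟨ cong (_⊕ span w′) (span-∷ a w) ⟨
  span (a ∷ w) ⊕ span w′            ∎
  where open ≡-Reasoning

span-[inv] : ∀ a → span [ inv a ] ≡ ⊖ direction a
span-[inv] R = refl
span-[inv] L = refl
span-[inv] U = refl
span-[inv] D = refl

span-⁻¹ : ∀ w → span (w ⁻¹) ≡ ⊖ span w
span-⁻¹ []      = refl
span-⁻¹ (a ∷ w) = begin
  span (reverse (inv a ∷ map inv w))        ≡⟨ cong span (List.unfold-reverse (inv a) (map inv w)) ⟩
  span (w ⁻¹ ++ [ inv a ])                  ≡⟨ span-++ (w ⁻¹) [ inv a ] ⟩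
  span (w ⁻¹) ⊕ span [ inv a ]              ≡⟨ cong₂ _⊕_ (span-⁻¹ w) (span-[inv] a) ⟩
  ⊖ span w ⊕ ⊖ direction a                  ≡⟨ ⊕-comm (⊖ span w) (⊖ direction a) ⟩
  ⊖ direction a ⊕ ⊖ span w                  ≡⟨ ⊖-distrib-⊕ (direction a) (span w) ⟨
  ⊖ (direction a ⊕ span w)                  ≡⟨ cong ⊖_ (span-∷ a w) ⟨
  ⊖ span (a ∷ w)                            ∎
  where open ≡-Reasoning

-- The maps of Defs with _++_ and _⁻¹ abstracted; ChainMaps _++_ _⁻¹ unfolds to Defs' maps.
module ChainMaps {A : Set} (_∙_ : A → A → A) (_⁻ : A → A) where

  infix 30 _⟨_⟩
  _⟨_⟩ : (Fin 8 → A) → ℕ → A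
  s ⟨ n ⟩ = s ((n ℕ.+ 7) mod 8)

  tri : (Fin 8 → A) → ℕ → A
  tri s j = s ⟨ j ℕ.+ 3 ⟩ ∙ (s ⟨ j ℕ.+ 4 ⟩ ∙ s ⟨ j ℕ.+ 5 ⟩)

  pent : (Fin 8 → A) → ℕ → A
  pent s i = s ⟨ i ℕ.+ 6 ⟩ ∙ (s ⟨ i ℕ.+ 7 ⟩ ∙ (s ⟨ i ⟩ ∙ (s ⟨ i ℕ.+ 1 ⟩ ∙ s ⟨ i ℕ.+ 2 ⟩)))

  f : ℕ → (Fin 8 → A) → Fin 8 → A
  f i s k = if idx k % 4 ≡ᵇ i % 4 then tri s (idx k) ⁻ else s k

  gOdd : (Fin 8 → A) → Fin 8 → A
  gOdd s k = if isOdd (idx k) then pent s (idx k) ⁻ else tri s (idx k)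

  gEven : (Fin 8 → A) → Fin 8 → A
  gEven s k = if isOdd (idx k) then tri s (idx k) else pent s (idx k) ⁻

Move : Set₁
Move = ∀ {A : Set} → (A → A → A) → (A → A) → (Fin 8 → A) → Fin 8 → A

-- A record rather than a Π-type, and the target operations passed by name below, because
-- unification cannot recover _∙ᴮ_ and _⁻ᴮ from h x ∙ᴮ h y and h x ⁻ᴮ.
record Natural (φ : Move) : Set₁ where
  field
    natural :
      ∀ {A B : Set} {_∙_ : A → A → A} {_⁻ : A → A} {_∙ᴮ_ : B → B → B} {_⁻ᴮ : B → B}
      (h : A → B) → (∀ x y → h (x ∙ y) ≡ h x ∙ᴮ h y) → (∀ x → h (x ⁻) ≡ h x ⁻ᴮ) →
      ∀ {s t} → (∀ k → h (s k) ≡ t k) → ∀ k → h (φ _∙_ _⁻ s k) ≡ φ _∙ᴮ_ _⁻ᴮ t k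

fᴹ : ℕ → Move
fᴹ i _∙_ _⁻ = ChainMaps.f _∙_ _⁻ i

gOddᴹ gEvenᴹ : Move
gOddᴹ _∙_ _⁻ = ChainMaps.gOdd _∙_ _⁻
gEvenᴹ _∙_ _⁻ = ChainMaps.gEven _∙_ _⁻

module _ {A B : Set} {_∙_ : A → A → A} {_⁻ : A → A} {_∙ᴮ_ : B → B → B} {_⁻ᴮ : B → B}
         (h : A → B) (h-∙ : ∀ x y → h (x ∙ y) ≡ h x ∙ᴮ h y) (h-⁻ : ∀ x → h (x ⁻) ≡ h x ⁻ᴮ)
         {s : Fin 8 → A} {t : Fin 8 → B} (h∘s≗t : ∀ k → h (s k) ≡ t k) where

  private
    module S = ChainMaps _∙_ _⁻
    module T = ChainMaps _∙ᴮ_ _⁻ᴮ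

    h-∙₃ : ∀ x y z → h (x ∙ (y ∙ z)) ≡ h x ∙ᴮ (h y ∙ᴮ h z)
    h-∙₃ x y z = trans (h-∙ x (y ∙ z)) (cong (h x ∙ᴮ_) (h-∙ y z))

    tri-natural : ∀ j → h (S.tri s j) ≡ T.tri t j
    tri-natural j = trans (h-∙₃ _ _ _) (cong₂ _∙ᴮ_ (h∘s≗t _) (cong₂ _∙ᴮ_ (h∘s≗t _) (h∘s≗t _)))

    pent-natural : ∀ i → h (S.pent s i) ≡ T.pent t i
    pent-natural i =
      trans (h-∙₃ _ _ _) (cong₂ _∙ᴮ_ (h∘s≗t _) (cong₂ _∙ᴮ_ (h∘s≗t _)
        (trans (h-∙₃ _ _ _) (cong₂ _∙ᴮ_ (h∘s≗t _) (cong₂ _∙ᴮ_ (h∘s≗t _) (h∘s≗t _))))))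

  f-natural : ∀ i k → h (S.f i s k) ≡ T.f i t k
  f-natural i k with idx k % 4 ≡ᵇ i % 4
  ... | true  = trans (h-⁻ _) (cong _⁻ᴮ (tri-natural (idx k)))
  ... | false = h∘s≗t k

  gOdd-natural : ∀ k → h (S.gOdd s k) ≡ T.gOdd t k
  gOdd-natural k with isOdd (idx k)
  ... | true  = trans (h-⁻ _) (cong _⁻ᴮ (pent-natural (idx k)))
  ... | false = tri-natural (idx k)

  gEven-natural : ∀ k → h (S.gEven s k) ≡ T.gEven t k
  gEven-natural k with isOdd (idx k)
  ... | true  = tri-natural (idx k)
  ... | false = trans (h-⁻ _) (cong _⁻ᴮ (pent-natural (idx k)))

fᴹ-natural : ∀ i → Natural (fᴹ i)
Natural.natural (fᴹ-natural i) {_∙ᴮ_ = _∙ᴮ_} {_⁻ᴮ = _⁻ᴮ} h h-∙ h-⁻ h∘s≗t =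
  f-natural {_∙ᴮ_ = _∙ᴮ_} {_⁻ᴮ = _⁻ᴮ} h h-∙ h-⁻ h∘s≗t i

gOddᴹ-natural : Natural gOddᴹ
Natural.natural gOddᴹ-natural {_∙ᴮ_ = _∙ᴮ_} {_⁻ᴮ = _⁻ᴮ} = gOdd-natural {_∙ᴮ_ = _∙ᴮ_} {_⁻ᴮ = _⁻ᴮ}

gEvenᴹ-natural : Natural gEvenᴹ
Natural.natural gEvenᴹ-natural {_∙ᴮ_ = _∙ᴮ_} {_⁻ᴮ = _⁻ᴮ} = gEven-natural {_∙ᴮ_ = _∙ᴮ_} {_⁻ᴮ = _⁻ᴮ}

antipodal : ∀ {A : Set} {n} → (A → A) → Vec A n → Fin (n ℕ.+ n) → A
antipodal {n = n} _⁻ q k with splitAt n k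
... | inj₁ i = lookup q i
... | inj₂ i = lookup q i ⁻

antipodal-natural : ∀ {A B : Set} {_⁻ : A → A} {_⁻ᴮ : B → B} {n}
  (h : A → B) → (∀ x → h (x ⁻) ≡ h x ⁻ᴮ) →
  ∀ (q : Vec A n) k → h (antipodal _⁻ q k) ≡ antipodal _⁻ᴮ (Vec.map h q) k
antipodal-natural {_⁻ᴮ = _⁻ᴮ} {n = n} h h-⁻ q k with splitAt n k
... | inj₁ i = sym (Vec.lookup-map i h q)
... | inj₂ i = trans (h-⁻ (lookup q i)) (cong _⁻ᴮ (sym (Vec.lookup-map i h q)))

frame : ∀ {A : Set} {n} → (Fin (n ℕ.+ n) → A) → Vec A n
frame {n = n} s = tabulate (s ∘ (Fin._↑ˡ n))

infixl 6 _+ᶠ_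
infix 8 -ᶠ_

_+ᶠ_ : ∀ {n} → Vec ℤ n → Vec ℤ n → Vec ℤ n
_+ᶠ_ = zipWith _+_

-ᶠ_ : ∀ {n} → Vec ℤ n → Vec ℤ n
-ᶠ_ = Vec.map (λ a → - a)

infix 20 _⟪_⟫
_⟪_⟫ : ∀ {n} → Vec V n → Vec ℤ n → V
[]      ⟪ []    ⟫ = 𝟎
(u ∷ q) ⟪ a ∷ α ⟫ = a ⊛ u ⊕ q ⟪ α ⟫

⟪⟫-+ : ∀ {n} (q : Vec V n) α β → q ⟪ α +ᶠ β ⟫ ≡ q ⟪ α ⟫ ⊕ q ⟪ β ⟫
⟪⟫-+ []      []      []      = refl
⟪⟫-+ (u ∷ q) (a ∷ α) (b ∷ β) =
  trans (cong₂ _⊕_ (⊛-distribʳ-+ a b u) (⟪⟫-+ q α β))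
        (⊕-interchange (a ⊛ u) (b ⊛ u) (q ⟪ α ⟫) (q ⟪ β ⟫))

⟪⟫-neg : ∀ {n} (q : Vec V n) α → q ⟪ -ᶠ α ⟫ ≡ ⊖ q ⟪ α ⟫
⟪⟫-neg []      []      = refl
⟪⟫-neg (u ∷ q) (a ∷ α) =
  trans (cong₂ _⊕_ (-‿⊛ a u) (⟪⟫-neg q α)) (sym (⊖-distrib-⊕ (a ⊛ u) (q ⟪ α ⟫)))

⟪⟫-zero : ∀ {n} (q : Vec V n) → q ⟪ replicate n (+ 0) ⟫ ≡ 𝟎
⟪⟫-zero []      = refl
⟪⟫-zero (u ∷ q) = cong (+ 0 ⊛ u ⊕_) (⟪⟫-zero q)

𝐞 : ∀ {n} → Fin n → Vec ℤ n
𝐞 zero    = + 1 ∷ replicate _ (+ 0)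
𝐞 (suc i) = + 0 ∷ 𝐞 i

⟪𝐞⟫ : ∀ {n} (q : Vec V n) i → q ⟪ 𝐞 i ⟫ ≡ lookup q i
⟪𝐞⟫ (u ∷ q) zero    =
  trans (cong (+ 1 ⊛ u ⊕_) (⟪⟫-zero q)) (trans (⊕-identityʳ (+ 1 ⊛ u)) (⊛-identityˡ u))
⟪𝐞⟫ (u ∷ q) (suc i) = trans (cong (+ 0 ⊛ u ⊕_) (⟪𝐞⟫ q i)) (⊕-identityˡ (lookup q i))

𝐈 : ∀ {n} → Vec (Vec ℤ n) n
𝐈 = tabulate 𝐞

⟪𝐈⟫ : ∀ {n} (q : Vec V n) → Vec.map (q ⟪_⟫) 𝐈 ≡ q
⟪𝐈⟫ q = begin
  Vec.map (q ⟪_⟫) (tabulate 𝐞)  ≡⟨ Vec.tabulate-∘ (q ⟪_⟫) 𝐞 ⟨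
  tabulate (q ⟪_⟫ ∘ 𝐞)          ≡⟨ Vec.tabulate-cong (⟪𝐞⟫ q) ⟩
  tabulate (lookup q)           ≡⟨ Vec.tabulate∘lookup q ⟩
  q                             ∎
  where open ≡-Reasoning

-- The chain of the formal vectors ±eᵢ.  By naturality, a move sends the antipodal chain of
-- any frame q to the evaluation at q of its image of this chain.
genericChain : Fin 8 → Vec ℤ 4
genericChain = antipodal -ᶠ_ 𝐈

⟪genericChain⟫ : ∀ q k → q ⟪ genericChain k ⟫ ≡ antipodal ⊖_ q k
⟪genericChain⟫ q k =
  trans (antipodal-natural (q ⟪_⟫) (⟪⟫-neg q) 𝐈 k) (cong (λ r → antipodal ⊖_ r k) (⟪𝐈⟫ q))

pairs : ∀ {A : Set} → Vec A 4 → Vec (A × A) 6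
pairs (a ∷ b ∷ c ∷ d ∷ []) = (a , b) ∷ (a , c) ∷ (a , d) ∷ (b , c) ∷ (b , d) ∷ (c , d) ∷ []

plücker : Vec V 4 → Vec ℤ 6
plücker q = Vec.map (uncurry cross2) (pairs q)

Oriented : Vec V 4 → Set
Oriented q = All (+ 0 <_) (plücker q)

infix 7 _·_
_·_ : ∀ {n} → Vec ℤ n → Vec ℤ n → ℤ
[]      · []      = + 0
(a ∷ α) · (b ∷ β) = a * b + α · β

-- The 2 × 2 minors of the coefficient rows α, β are the Plücker coordinates of
-- the columns (αₖ , βₖ).
binet-cauchy : ∀ (α β : Vec ℤ 4) q → cross2 (q ⟪ α ⟫) (q ⟪ β ⟫) ≡ plücker (zip α β) · plücker q
binet-cauchy (a₁ ∷ a₂ ∷ a₃ ∷ a₄ ∷ []) (b₁ ∷ b₂ ∷ b₃ ∷ b₄ ∷ [])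
             ((x₁ , y₁) ∷ (x₂ , y₂) ∷ (x₃ , y₃) ∷ (x₄ , y₄) ∷ []) =
  expanded a₁ a₂ a₃ a₄ b₁ b₂ b₃ b₄ x₁ x₂ x₃ x₄ y₁ y₂ y₃ y₄
  where
  expanded : ∀ a₁ a₂ a₃ a₄ b₁ b₂ b₃ b₄ x₁ x₂ x₃ x₄ y₁ y₂ y₃ y₄ →
    (a₁ * x₁ + (a₂ * x₂ + (a₃ * x₃ + (a₄ * x₄ + + 0))))
      * (b₁ * y₁ + (b₂ * y₂ + (b₃ * y₃ + (b₄ * y₄ + + 0))))
    - (a₁ * y₁ + (a₂ * y₂ + (a₃ * y₃ + (a₄ * y₄ + + 0))))
      * (b₁ * x₁ + (b₂ * x₂ + (b₃ * x₃ + (b₄ * x₄ + + 0))))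
    ≡ (a₁ * b₂ - b₁ * a₂) * (x₁ * y₂ - y₁ * x₂) + ((a₁ * b₃ - b₁ * a₃) * (x₁ * y₃ - y₁ * x₃)
    + ((a₁ * b₄ - b₁ * a₄) * (x₁ * y₄ - y₁ * x₄) + ((a₂ * b₃ - b₂ * a₃) * (x₂ * y₃ - y₂ * x₃)
    + ((a₂ * b₄ - b₂ * a₄) * (x₂ * y₄ - y₂ * x₄) + ((a₃ * b₄ - b₃ * a₄) * (x₃ * y₄ - y₃ * x₄)
    + + 0)))))
  expanded = solve-∀

Semipositive : ∀ {n} → Vec ℤ n → Set
Semipositive m = All (+ 0 ≤_) m × Any (+ 0 <_) m

semipositive? : ∀ {n} (m : Vec ℤ n) → Dec (Semipositive m)
semipositive? m = all? (+ 0 ≤?_) m ×-dec any? (+ 0 <?_) m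

nonneg*pos : ∀ {a b} → + 0 ≤ a → + 0 < b → + 0 ≤ a * b
nonneg*pos {+0}       _ _                = +≤+ z≤n
nonneg*pos {+[1+ m ]} _ (+<+ (s≤s z≤n)) = +≤+ z≤n

pos*pos : ∀ {a b} → + 0 < a → + 0 < b → + 0 < a * b
pos*pos (+<+ (s≤s z≤n)) (+<+ (s≤s z≤n)) = +<+ (s≤s z≤n)

nonnegative·positive : ∀ {n} {m p : Vec ℤ n} → All (+ 0 ≤_) m → All (+ 0 <_) p → + 0 ≤ m · p
nonnegative·positive []         []         = +≤+ z≤n
nonnegative·positive (m≥0 ∷ ms) (p>0 ∷ ps) = ℤ.+-mono-≤ (nonneg*pos m≥0 p>0) (nonnegative·positive ms ps)

semipositive·positive : ∀ {n} {m p : Vec ℤ n} → Semipositive m → All (+ 0 <_) p → + 0 < m · p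
semipositive·positive (m≥0 ∷ ms , here m>0) (p>0 ∷ ps) =
  ℤ.+-mono-<-≤ (pos*pos m>0 p>0) (nonnegative·positive ms ps)
semipositive·positive (m≥0 ∷ ms , there m>0) (p>0 ∷ ps) =
  ℤ.+-mono-≤-< (nonneg*pos m≥0 p>0) (semipositive·positive (ms , m>0) ps)

MinorsSemipositive : Vec (Vec ℤ 4) 4 → Set
MinorsSemipositive M = All (λ (α , β) → Semipositive (plücker (zip α β))) (pairs M)

oriented-combinations : ∀ M q → MinorsSemipositive M → Oriented q → Oriented (Vec.map (q ⟪_⟫) M)
oriented-combinations (_ ∷ _ ∷ _ ∷ _ ∷ []) q (s₁₂ ∷ s₁₃ ∷ s₁₄ ∷ s₂₃ ∷ s₂₄ ∷ s₃₄ ∷ []) q-oriented =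
  positive s₁₂ ∷ positive s₁₃ ∷ positive s₁₄ ∷ positive s₂₃ ∷ positive s₂₄ ∷ positive s₃₄ ∷ []
  where
  positive : ∀ {α β} → Semipositive (plücker (zip α β)) → + 0 < cross2 (q ⟪ α ⟫) (q ⟪ β ⟫)
  positive {α} {β} s =
    subst (+ 0 <_) (sym (binet-cauchy α β q)) (semipositive·positive s q-oriented)

formalImage : Move → Fin 8 → Vec ℤ 4
formalImage φ = φ _+ᶠ_ -ᶠ_ genericChain

matrix : Move → Vec (Vec ℤ 4) 4
matrix φ = frame (formalImage φ)

Admissible : Move → Set
Admissible φ = (∀ k → formalImage φ k ≡ antipodal -ᶠ_ (matrix φ) k) × MinorsSemipositive (matrix φ)

admissible? : (φ : Move) → Dec (Admissible φ)
admissible? φ =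
  Fin.all? (λ k → Vec.≡-dec ℤ._≟_ _ _) ×-dec all? (λ (α , β) → semipositive? (plücker (zip α β))) _

record PositiveFrame (C : Chain) : Set where
  field
    vectors           : Vec V 4
    partial-antipodal : ∀ k → partial C k ≡ antipodal ⊖_ vectors k
    oriented          : Oriented vectors

admissible-preserves : ∀ {C} (φ : Move) → Natural φ → Admissible φ →
  PositiveFrame C → PositiveFrame (φ _++_ _⁻¹ C)
admissible-preserves {C} φ φ-natural (image-antipodal , minors-semipositive) P = record
  { vectors           = Vec.map (q ⟪_⟫) (matrix φ)
  ; partial-antipodal = image-partial-antipodal
  ; oriented          = oriented-combinations (matrix φ) q minors-semipositive oriented
  }
  where
  open PositiveFrame P renaming (vectors to q)
  open Natural φ-natural
  open ≡-Reasoning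

  image-partial-antipodal : ∀ k → partial (φ _++_ _⁻¹ C) k ≡ antipodal ⊖_ (Vec.map (q ⟪_⟫) (matrix φ)) k
  image-partial-antipodal k = begin
    span (φ _++_ _⁻¹ C k)
      ≡⟨ natural span span-++ span-⁻¹ partial-antipodal k ⟩
    φ _⊕_ ⊖_ (antipodal ⊖_ q) k
      ≡⟨ natural (q ⟪_⟫) (⟪⟫-+ q) (⟪⟫-neg q) (⟪genericChain⟫ q) k ⟨
    q ⟪ formalImage φ k ⟫
      ≡⟨ cong (q ⟪_⟫) (image-antipodal k) ⟩
    q ⟪ antipodal -ᶠ_ (matrix φ) k ⟫
      ≡⟨ antipodal-natural (q ⟪_⟫) (⟪⟫-neg q) (matrix φ) k ⟩
    antipodal ⊖_ (Vec.map (q ⟪_⟫) (matrix φ)) k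
      ∎

step-preserves : ∀ {C C′} → Step C C′ → PositiveFrame C → PositiveFrame C′
step-preserves (stepF₁ _)    = admissible-preserves (fᴹ 1) (fᴹ-natural 1) (from-yes (admissible? (fᴹ 1)))
step-preserves (stepF₂ _)    = admissible-preserves (fᴹ 2) (fᴹ-natural 2) (from-yes (admissible? (fᴹ 2)))
step-preserves (stepF₃ _)    = admissible-preserves (fᴹ 3) (fᴹ-natural 3) (from-yes (admissible? (fᴹ 3)))
step-preserves (stepF₄ _)    = admissible-preserves (fᴹ 4) (fᴹ-natural 4) (from-yes (admissible? (fᴹ 4)))
step-preserves (stepGOdd _)  = admissible-preserves gOddᴹ gOddᴹ-natural (from-yes (admissible? gOddᴹ))
step-preserves (stepGEven _) = admissible-preserves gEvenᴹ gEvenᴹ-natural (from-yes (admissible? gEvenᴹ))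

greekFrame : Vec V 4
greekFrame = (+ 1 , + 0) ∷ (+ 1 , + 1) ∷ (+ 0 , + 1) ∷ (- + 1 , + 1) ∷ []

greekCross-positive : PositiveFrame greekCross
greekCross-positive = record
  { vectors           = greekFrame
  ; partial-antipodal = from-yes (Fin.all? λ k →
      Product.≡-dec ℤ._≟_ ℤ._≟_ (partial greekCross k) (antipodal ⊖_ greekFrame k))
  ; oriented          = from-yes (all? (+ 0 <?_) (plücker greekFrame))
  }

descendant-positive : ∀ {C} → Descendant C → PositiveFrame C
descendant-positive cross      = greekCross-positive
descendant-positive (step d s) = step-preserves s (descendant-positive d)

oriented-antipodal : ∀ q → Oriented q → (i j : Fin 8) → toℕ i ℕ.< toℕ j → toℕ j ℕ.< 4 →
  + 0 < cross2 (antipodal ⊖_ q i) (antipodal ⊖_ q j)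
oriented-antipodal (_ ∷ _ ∷ _ ∷ _ ∷ []) (p ∷ _) zero (suc zero) _ _ = p
oriented-antipodal (_ ∷ _ ∷ _ ∷ _ ∷ []) (_ ∷ p ∷ _) zero (suc (suc zero)) _ _ = p
oriented-antipodal (_ ∷ _ ∷ _ ∷ _ ∷ []) (_ ∷ _ ∷ p ∷ _) zero (suc (suc (suc zero))) _ _ = p
oriented-antipodal (_ ∷ _ ∷ _ ∷ _ ∷ []) (_ ∷ _ ∷ _ ∷ p ∷ _) (suc zero) (suc (suc zero)) _ _ = p
oriented-antipodal (_ ∷ _ ∷ _ ∷ _ ∷ []) (_ ∷ _ ∷ _ ∷ _ ∷ p ∷ _) (suc zero) (suc (suc (suc zero))) _ _ = p
oriented-antipodal (_ ∷ _ ∷ _ ∷ _ ∷ []) (_ ∷ _ ∷ _ ∷ _ ∷ _ ∷ p ∷ _)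
                   (suc (suc zero)) (suc (suc (suc zero))) _ _ = p
oriented-antipodal _ _ _ zero () _
oriented-antipodal _ _ (suc _) (suc zero) (s≤s ()) _
oriented-antipodal _ _ (suc (suc _)) (suc (suc zero)) (s≤s (s≤s ())) _
oriented-antipodal _ _ (suc (suc (suc _))) (suc (suc (suc zero))) (s≤s (s≤s (s≤s ()))) _
oriented-antipodal _ _ _ (suc (suc (suc (suc _)))) _ (s≤s (s≤s (s≤s (s≤s ()))))

lemma13 : (C : Chain) → Descendant C →
    (i j : Fin 8) → toℕ i Data.Nat.< toℕ j → toℕ j Data.Nat.< 4 →
    cross2 (partial C i) (partial C j) > + 0
lemma13 C d i j i<j j<4 =
  subst₂ (λ u v → cross2 u v > + 0) (sym (partial-antipodal i)) (sym (partial-antipodal j))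
    (oriented-antipodal vectors oriented i j i<j j<4)
  where open PositiveFrame (descendant-positive d)
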